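{- Let $G$ be a $6$-minimal graph with maximum degree at most $3$ and girth at least $7$. Then $G$ does not contain a $Y$-configuration, that is, a vertex $v$ of class $1$ that is adjacent to a vertex of class $2$, adjacent to a vertex of class $1$, and at distance two from a vertex of class $3$.
   Context: All graphs are finite and simple. The square $G^2$ of $G$ has vertex set $V(G)$, with two vertices adjacent if their distance in $G$ is at most $2$. A graph is $k$-choosable if it admits a proper coloring from any assignment of lists of size $k$. A graph $G$ is $k$-minimal if $G^2$ is not $k$-choosable but $H^2$ is $k$-choosable for every proper subgraph $H$ of $G$. A vertex of degree $3$ is of class $i$ if it is adjacent to exactly $i$ vertices of degree $2$. -}

module Defs where

open import Data.Nat using (ℕ; zero; suc; _+_; _≤_)
open import Data.Fin using (Fin; zero; suc; inject₁; fromℕ)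
open import Data.Bool using (Bool; true; false; if_then_else_)
open import Data.List using (List; length; map; allFin)
open import Data.Nat.ListAction using (sum)
open import Data.List.Membership.Propositional using (_∈_)
open import Data.List.Relation.Unary.Unique.Propositional using (Unique)
open import Data.Product using (Σ; ∃; ∃-syntax; _×_; _,_)
open import Data.Sum using (_⊎_)
open import Relation.Nullary using (¬_)
open import Relation.Binary.PropositionalEquality using (_≡_; _≢_)
open import Function.Definitions using (Injective)

record Graph (n : ℕ) : Set where
  field
    adj   : Fin n → Fin n → Bool
    sym   : ∀ u v → adj u v ≡ adj v u
    irrefl : ∀ v → adj v v ≡ false
open Graph public

record Subgraph {n : ℕ} (G : Graph n) : Set where
  field
    vs     : Fin n → Bool
    ad     : Fin n → Fin n → Bool
    ad-sym : ∀ u v → ad u v ≡ ad v u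
    ad⊆    : ∀ u v → ad u v ≡ true → adj G u v ≡ true
    ad-vs  : ∀ u v → ad u v ≡ true → vs u ≡ true
open Subgraph public

full : ∀ {n} (G : Graph n) → Subgraph G
full G = record
  { vs = λ _ → true ; ad = adj G ; ad-sym = sym G
  ; ad⊆ = λ u v p → p ; ad-vs = λ u v p → _≡_.refl }

Proper : ∀ {n} {G : Graph n} → Subgraph G → Set
Proper {n} {G} H =
  (∃[ v ] vs H v ≡ false) ⊎ (∃[ u ] ∃[ v ] (adj G u v ≡ true × ad H u v ≡ false))

Sq : ∀ {n} {G : Graph n} → Subgraph G → Fin n → Fin n → Set
Sq {n} H u v = u ≢ v × (ad H u v ≡ true ⊎ ∃[ w ] (ad H u w ≡ true × ad H w v ≡ true))

SqChoosable : ∀ {n} {G : Graph n} → Subgraph G → ℕ → Set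
SqChoosable {n} {G} H k =
  (L : Fin n → List ℕ) →
  (∀ v → vs H v ≡ true → Unique (L v) × length (L v) ≡ k) →
  Σ (Fin n → ℕ) λ c → ((∀ v → vs H v ≡ true → c v ∈ L v) ×
          (∀ u v → vs H u ≡ true → vs H v ≡ true → Sq {n} {G} H u v → c u ≢ c v))

Minimal : ∀ {n} → Graph n → ℕ → Set
Minimal G k = ¬ SqChoosable (full G) k × ((H : Subgraph G) → Proper H → SqChoosable H k)

deg : ∀ {n} → Graph n → Fin n → ℕ
deg {n} G v = sum (map (λ u → if adj G v u then 1 else 0) (allFin n))

MaxDegLe : ∀ {n} → Graph n → ℕ → Set
MaxDegLe G d = ∀ v → deg G v ≤ d

-- A cycle of length 3+m in G: distinct vertices f 0, …, f (2+m), consecutive ones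
-- adjacent and the last adjacent to the first.
Cycle : ∀ {n} → Graph n → ℕ → Set
Cycle {n} G m =
  Σ (Fin (suc (suc (suc m))) → Fin n) λ f →
    Injective _≡_ _≡_ f ×
    (∀ (i : Fin (suc (suc m))) → adj G (f (inject₁ i)) (f (suc i)) ≡ true) ×
    adj G (f (fromℕ (suc (suc m)))) (f zero) ≡ true

-- Girth at least g (acyclic graphs have infinite girth).
GirthGe : ∀ {n} → Graph n → ℕ → Set
GirthGe G g = ∀ m → Cycle G m → g ≤ suc (suc (suc m))

deg2nbrs : ∀ {n} → Graph n → Fin n → ℕ
deg2nbrs {n} G v =
  sum (map (λ u → if adj G v u then (if isTwo (deg G u) then 1 else 0) else 0) (allFin n))
  where
  isTwo : ℕ → Bool
  isTwo (suc (suc zero)) = true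
  isTwo _ = false

Class : ∀ {n} → Graph n → ℕ → Fin n → Set
Class G i v = deg G v ≡ 3 × deg2nbrs G v ≡ i

Dist2 : ∀ {n} → Graph n → Fin n → Fin n → Set
Dist2 G u v = u ≢ v × adj G u v ≡ false × ∃[ w ] (adj G u w ≡ true × adj G w v ≡ true)

YConf : ∀ {n} → Graph n → Fin n → Set
YConf G v =
  Class G 1 v ×
  (∃[ a ] (adj G v a ≡ true × Class G 2 a)) ×
  (∃[ b ] (adj G v b ≡ true × Class G 1 b)) ×
  (∃[ c ] (Dist2 G v c × Class G 3 c))

-- Let v be the centre of a Y-configuration, with neighbours a (class 2), b (class 1) and w; then
-- w is the degree-2 neighbour of v, a has two degree-2 neighbours a₁, a₂ and b has one, b₁.
-- Delete the core S = {v, a, b, w, a₁, a₂, b₁}: by minimality the square of G − S is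
-- 6-choosable. Each core vertex has at most one neighbour outside S, so deleting S destroys no
-- adjacency of the square between remaining vertices, and after colouring G − S the core vertices
-- v, a keep 4 available colours, w, a₁, a₂ keep 3 and b, b₁ keep 2. Girth 7 leaves only 13 edges
-- of G² inside S, and that graph is colourable from such lists, so G² would be 6-choosable.
module Submission where

open import Defs hiding (sym)
open import Data.Nat using (ℕ; suc; _+_; _≤_; _<_; s≤s; z≤n)
import Data.Nat as ℕ
open import Data.Nat.Base using (z<s; s<s)
open import Data.Nat.ListAction using (sum)
open import Data.Nat.Properties
  using (≤-refl; ≤-reflexive; ≤-trans; ≤-pred; <-≤-trans; +-suc; ≰⇒>; _≤?_; +-monoˡ-≤; +-monoʳ-≤;
         n≤1+n; n≮n; <⇒≱)
open import Data.Fin using (Fin; zero; suc; inject₁; fromℕ; _≟_)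
open import Data.Bool using (Bool; true; false; not; _∧_; if_then_else_)
open import Data.Bool.Properties using (T-≡; ∧-comm; ∧-conicalˡ; ∧-conicalʳ)
open import Data.List using (List; []; _∷_; length; filter; map; allFin; _++_; concatMap)
open import Data.List.Properties using (filter-notAll; length-++; length-map; map-cong; ++-identityʳ)
open import Data.List.Membership.Propositional using (_∈_; _∉_; find; lose)
open import Data.List.Membership.Propositional.Properties
  using (∈-filter⁺; ∈-filter⁻; ∈-++⁺ˡ; ∈-++⁺ʳ; ∈-++⁻; ∈-map⁺; ∈-map⁻; ∈-concatMap⁺; ∈-allFin)
import Data.List.Membership.DecPropositional as DecMembership
open import Data.List.Relation.Unary.Any as Any using (here; there; any?; satisfied)
open import Data.List.Relation.Unary.All as All using (All; []; _∷_)
open import Data.List.Relation.Unary.Unique.Propositional using (Unique; []; _∷_)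
open import Data.List.Relation.Unary.Unique.Propositional.Properties using (allFin⁺; filter⁺)
open import Data.List.Relation.Binary.Subset.Propositional using (_⊆_)
open import Data.List.Relation.Binary.Disjoint.Propositional using (Disjoint)
open import Data.Vec using (Vec; []; _∷_; lookup; last; head)
open import Data.Vec.Relation.Unary.Linked using (Linked; [-]; _∷_)
open import Data.Vec.Relation.Unary.AllPairs using ([]; _∷_)
open import Data.Vec.Relation.Unary.All using ([]; _∷_)
import Data.Vec.Relation.Unary.Unique.Propositional as Vec
open import Data.Vec.Relation.Unary.Unique.Propositional.Properties using (lookup-injective)
open import Data.Product using (Σ-syntax; ∃; _×_; _,_; proj₁; proj₂; curry)
open import Data.Sum using (_⊎_; inj₁; inj₂; [_,_])
open import Data.Empty using (⊥)
open import Function using (_∘_; Equivalence)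
open import Relation.Unary using (Decidable)
open import Relation.Nullary using (¬_; Dec; yes; no; ¬?; does; contradiction; map′)
open import Relation.Nullary.Decidable using (T?; decidable-stable)
open import Relation.Binary.Definitions using (DecidableEquality)
open import Relation.Binary.PropositionalEquality
  using (_≡_; _≢_; refl; sym; trans; cong; cong₂; subst; subst₂; ≢-sym; module ≡-Reasoning)

∉-head : ∀ {A : Set} {x y : A} {ys} → x ∉ y ∷ ys → x ≢ y
∉-head x∉ x≡y = x∉ (here x≡y)

∉-tail : ∀ {A : Set} {x y : A} {ys} → x ∉ y ∷ ys → x ∉ ys
∉-tail x∉ x∈ = x∉ (there x∈)

∈∧∉⇒≢ : ∀ {A : Set} {x y : A} {xs} → x ∈ xs → y ∉ xs → x ≢ y
∈∧∉⇒≢ x∈ y∉ refl = y∉ x∈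

∉⇒Unique-∷ : ∀ {A : Set} {x : A} {xs} → x ∉ xs → Unique xs → Unique (x ∷ xs)
∉⇒Unique-∷ {xs = xs} x∉ uxs = All.tabulate (λ y∈ x≡y → x∉ (subst (_∈ xs) (sym x≡y) y∈)) ∷ uxs

∈-≤1⇒≡ : ∀ {A : Set} {xs : List A} {x y} → length xs ≤ 1 → x ∈ xs → y ∈ xs → x ≡ y
∈-≤1⇒≡ {xs = _ ∷ []} _ (here refl) (here refl) = refl
∈-≤1⇒≡ {xs = _ ∷ _ ∷ _} (s≤s ())

sum-if : ∀ {A : Set} {P : A → Set} (P? : Decidable P) (f : A → ℕ) xs →
  sum (map (λ x → if does (P? x) then f x else 0) xs) ≡ sum (map f (filter P? xs))
sum-if P? f [] = refl
sum-if P? f (x ∷ xs) with does (P? x)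
... | true = cong (f x +_) (sum-if P? f xs)
... | false = sum-if P? f xs

count≡length-filter : ∀ {A : Set} {P : A → Set} (P? : Decidable P) xs →
  sum (map (λ x → if does (P? x) then 1 else 0) xs) ≡ length (filter P? xs)
count≡length-filter P? [] = refl
count≡length-filter P? (x ∷ xs) with does (P? x)
... | true = cong suc (count≡length-filter P? xs)
... | false = count≡length-filter P? xs

module _ {A : Set} (_≟ᴬ_ : DecidableEquality A) where

  open DecMembership _≟ᴬ_ using (_∈?_)

  longer⇒∃∉ : ∀ {xs} ys → Unique xs → length ys < length xs → ∃ λ x → x ∈ xs × x ∉ ys
  longer⇒∃∉ {x ∷ xs} ys (x∉xs ∷ uxs) ys<xs with x ∈? ys
  ... | no x∉ys = x , here refl , x∉ys
  ... | yes x∈ys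
    with z , z∈xs , z∉ys∖x ← longer⇒∃∉ (filter (λ y → ¬? (y ≟ᴬ x)) ys) uxs
           (<-≤-trans (filter-notAll _ ys (Any.map (λ x≡y y≢x → y≢x (sym x≡y)) x∈ys)) (≤-pred ys<xs))
    = z , there z∈xs , λ z∈ys → z∉ys∖x (∈-filter⁺ _ z∈ys (λ z≡x → All.lookup x∉xs z∈xs (sym z≡x)))

  Unique∧⊆⇒length≤ : ∀ {xs ys} → Unique xs → xs ⊆ ys → length xs ≤ length ys
  Unique∧⊆⇒length≤ {xs} {ys} uxs xs⊆ys with length xs ≤? length ys
  ... | yes xs≤ys = xs≤ys
  ... | no xs≰ys with x , x∈xs , x∉ys ← longer⇒∃∉ ys uxs (≰⇒> xs≰ys) = contradiction (xs⊆ys x∈xs) x∉ys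

  ∃-sublist-avoiding : ∀ {xs} → Unique xs → ∀ ys k → length ys + k ≤ length xs →
    Σ[ zs ∈ List A ] Unique zs × length zs ≡ k × zs ⊆ xs × Disjoint zs ys
  ∃-sublist-avoiding uxs ys 0 _ = [] , [] , refl , (λ ()) , λ ()
  ∃-sublist-avoiding {xs} uxs ys (suc k) bound
    with zs , uzs , refl , zs⊆xs , zs∩ys ←
           ∃-sublist-avoiding uxs ys k (≤-trans (+-monoʳ-≤ (length ys) (n≤1+n k)) bound)
    with z , z∈xs , z∉ys++zs ←
           longer⇒∃∉ (ys ++ zs) uxs
             (subst (_< length xs) (sym (length-++ ys)) (subst (_≤ length xs) (+-suc (length ys) k) bound))
    = z ∷ zs
    , ∉⇒Unique-∷ (z∉ys++zs ∘ ∈-++⁺ʳ ys) uzs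
    , refl
    , (λ { (here refl) → z∈xs ; (there z′∈zs) → zs⊆xs z′∈zs })
    , λ { (here refl , z∈ys) → z∉ys++zs (∈-++⁺ˡ z∈ys) ; (there z′∈zs , z′∈ys) → zs∩ys (z′∈zs , z′∈ys) }

Adj : ∀ {n} → Graph n → Fin n → Fin n → Set
Adj G u v = adj G u v ≡ true

-- The summand of deg2nbrs tests degrees with a helper local to its where-block, which cannot be
-- named here; unification still lets us name the summand itself.
deg2nbrs-summand : ∀ {n} (G : Graph n) x → Σ[ t ∈ (Fin n → ℕ) ] deg2nbrs G x ≡ sum (map t (allFin n))
deg2nbrs-summand G x = _ , refl

deg2nbrs-summand≡ : ∀ {n} (G : Graph n) x u →
  proj₁ (deg2nbrs-summand G x) u ≡ (if adj G x u then (if does (deg G u ℕ.≟ 2) then 1 else 0) else 0)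
deg2nbrs-summand≡ G x u with adj G x u | deg G u
... | false | _ = refl
... | true | 0 = refl
... | true | 1 = refl
... | true | 2 = refl
... | true | suc (suc (suc _)) = refl

module _ {n} (G : Graph n) where

  open DecMembership (_≟_ {n}) using (_∈?_)

  Adj-sym : ∀ {u v} → Adj G u v → Adj G v u
  Adj-sym {u} {v} u~v = trans (Graph.sym G v u) u~v

  Adj⇒≢ : ∀ {u v} → Adj G u v → u ≢ v
  Adj⇒≢ {u} u~u refl with () ← trans (sym (irrefl G u)) u~u

  Sq-sym : ∀ {u v} → Sq (full G) u v → Sq (full G) v u
  Sq-sym (u≢v , inj₁ u~v) = ≢-sym u≢v , inj₁ (Adj-sym u~v)
  Sq-sym (u≢v , inj₂ (m , u~m , m~v)) = ≢-sym u≢v , inj₂ (m , Adj-sym m~v , Adj-sym u~m)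

  deg₃≢deg₂ : ∀ {x y} → deg G x ≡ 3 → deg G y ≡ 2 → x ≢ y
  deg₃≢deg₂ deg-x deg-y refl with () ← trans (sym deg-x) deg-y

  nbrs : Fin n → List (Fin n)
  nbrs x = filter (T? ∘ adj G x) (allFin n)

  ∈-nbrs⁺ : ∀ {x u} → Adj G x u → u ∈ nbrs x
  ∈-nbrs⁺ {x} {u} x~u = ∈-filter⁺ (T? ∘ adj G x) (∈-allFin u) (Equivalence.from T-≡ x~u)

  ∈-nbrs⁻ : ∀ {x u} → u ∈ nbrs x → Adj G x u
  ∈-nbrs⁻ {x} u∈ = Equivalence.to T-≡ (proj₂ (∈-filter⁻ (T? ∘ adj G x) {xs = allFin n} u∈))

  nbrs-unique : ∀ x → Unique (nbrs x)
  nbrs-unique x = filter⁺ (T? ∘ adj G x) (allFin⁺ n)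

  deg≡length-nbrs : ∀ x → deg G x ≡ length (nbrs x)
  deg≡length-nbrs x = count≡length-filter (T? ∘ adj G x) (allFin n)

  Nbrs⊆ : Fin n → List (Fin n) → Set
  Nbrs⊆ x ys = ∀ {u} → Adj G x u → u ∈ ys

  ∃-neighbour-∉ : ∀ {x} ys → length ys < deg G x → ∃ λ u → Adj G x u × u ∉ ys
  ∃-neighbour-∉ {x} ys ys<deg
    with u , u∈ , u∉ ← longer⇒∃∉ _≟_ ys (nbrs-unique x) (subst (length ys <_) (deg≡length-nbrs x) ys<deg)
    = u , ∈-nbrs⁻ u∈ , u∉

  distinct-neighbours≤deg : ∀ {x ys} → Unique ys → All (Adj G x) ys → length ys ≤ deg G x
  distinct-neighbours≤deg {x} uys x~ys =
    subst (_ ≤_) (sym (deg≡length-nbrs x)) (Unique∧⊆⇒length≤ _≟_ uys (∈-nbrs⁺ ∘ All.lookup x~ys))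

  neighbours-⊆ : ∀ {x ys} → deg G x ≤ length ys → Unique ys → All (Adj G x) ys → Nbrs⊆ x ys
  neighbours-⊆ {x} {ys} deg≤ uys x~ys {u} x~u with u ∈? ys
  ... | yes u∈ = u∈
  ... | no u∉ = contradiction
    (≤-trans (distinct-neighbours≤deg (∉⇒Unique-∷ u∉ uys) (x~u ∷ x~ys)) deg≤) (n≮n _)

  second-neighbour : ∀ {x p} → deg G x ≡ 2 → Adj G x p → ∃ λ q → Adj G x q × Nbrs⊆ x (p ∷ q ∷ [])
  second-neighbour {x} {p} deg-x x~p
    with q , x~q , q∉ ← ∃-neighbour-∉ (p ∷ []) (subst (1 <_) (sym deg-x) ≤-refl)
    = q , x~q , neighbours-⊆ (≤-reflexive deg-x) ((≢-sym (∉-head q∉) ∷ []) ∷ [] ∷ []) (x~p ∷ x~q ∷ [])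

  deg₂-nbrs : Fin n → List (Fin n)
  deg₂-nbrs x = filter (λ u → deg G u ℕ.≟ 2) (nbrs x)

  deg2nbrs≡length : ∀ x → deg2nbrs G x ≡ length (deg₂-nbrs x)
  deg2nbrs≡length x = begin
    deg2nbrs G x
      ≡⟨ proj₂ (deg2nbrs-summand G x) ⟩
    sum (map (proj₁ (deg2nbrs-summand G x)) (allFin n))
      ≡⟨ cong sum (map-cong (deg2nbrs-summand≡ G x) (allFin n)) ⟩
    sum (map (λ u → if adj G x u then deg₂ u else 0) (allFin n))
      ≡⟨ sum-if (T? ∘ adj G x) deg₂ (allFin n) ⟩
    sum (map deg₂ (nbrs x))
      ≡⟨ count≡length-filter (λ u → deg G u ℕ.≟ 2) (nbrs x) ⟩
    length (deg₂-nbrs x) ∎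
    where
    open ≡-Reasoning
    deg₂ : Fin n → ℕ
    deg₂ u = if does (deg G u ℕ.≟ 2) then 1 else 0

  ∃-deg₂-neighbour-∉ : ∀ {x} zs → length zs < deg2nbrs G x → ∃ λ u → Adj G x u × deg G u ≡ 2 × u ∉ zs
  ∃-deg₂-neighbour-∉ {x} zs zs<
    with u , u∈ , u∉ ← longer⇒∃∉ _≟_ zs (filter⁺ _ (nbrs-unique x))
                         (subst (length zs <_) (deg2nbrs≡length x) zs<)
    = let u∈N , deg₂ = ∈-filter⁻ (λ u → deg G u ℕ.≟ 2) u∈ in u , ∈-nbrs⁻ u∈N , deg₂ , u∉

  nbrsExcept : Fin n → Fin n → List (Fin n)
  nbrsExcept y x = filter (λ u → ¬? (u ≟ x)) (nbrs y)

  ∈-nbrsExcept : ∀ {y x u} → Adj G y u → u ≢ x → u ∈ nbrsExcept y x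
  ∈-nbrsExcept y~u u≢x = ∈-filter⁺ _ (∈-nbrs⁺ y~u) u≢x

  |nbrsExcept|<deg : ∀ {y x} → Adj G y x → length (nbrsExcept y x) < deg G y
  |nbrsExcept|<deg {y} {x} y~x = subst (length (nbrsExcept y x) <_) (sym (deg≡length-nbrs y))
    (filter-notAll (λ u → ¬? (u ≟ x)) (nbrs y) (Any.map (λ x≡u u≢x → u≢x (sym x≡u)) (∈-nbrs⁺ y~x)))

lookup-fromℕ≡last : ∀ {A : Set} {k} (xs : Vec A (suc k)) → lookup xs (fromℕ k) ≡ last xs
lookup-fromℕ≡last (x ∷ []) = refl
lookup-fromℕ≡last (x ∷ y ∷ xs) = lookup-fromℕ≡last (y ∷ xs)

module _ {n} (G : Graph n) where

  Linked-lookup : ∀ {k} {xs : Vec (Fin n) (suc k)} → Linked (Adj G) xs →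
    ∀ i → Adj G (lookup xs (inject₁ i)) (lookup xs (suc i))
  Linked-lookup {xs = _ ∷ _ ∷ _} (x~y ∷ _) zero = x~y
  Linked-lookup (_ ∷ path) (suc i) = Linked-lookup path i

  cycle : ∀ {m} (xs : Vec (Fin n) (3 + m)) → Vec.Unique xs → Linked (Adj G) xs →
    Adj G (last xs) (head xs) → Cycle G m
  cycle xs@(x ∷ _) distinct path closing =
    lookup xs , lookup-injective distinct _ _ , Linked-lookup path ,
    subst (λ u → Adj G u x) (sym (lookup-fromℕ≡last xs)) closing

  module _ (girth : GirthGe G 7) where

    short-cycle-free : ∀ {m} (xs : Vec (Fin n) (3 + m)) → m < 4 → Vec.Unique xs → Linked (Adj G) xs →
      Adj G (last xs) (head xs) → ⊥
    short-cycle-free {m} xs m<4 distinct path closing =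
      <⇒≱ (s≤s (s≤s (s≤s m<4))) (girth m (cycle xs distinct path closing))

    triangle-free : ∀ {x y z} → Adj G x y → Adj G y z → Adj G z x → ⊥
    triangle-free x~y y~z z~x = short-cycle-free (_ ∷ _ ∷ _ ∷ []) z<s
      ((Adj⇒≢ G x~y ∷ ≢-sym (Adj⇒≢ G z~x) ∷ []) ∷ (Adj⇒≢ G y~z ∷ []) ∷ [] ∷ [])
      (x~y ∷ y~z ∷ [-]) z~x

    Path : ∀ {k} → Vec (Fin n) k → Set
    Path xs = Vec.Unique xs × Linked (Adj G) xs

    ¬Sq-ends-of-path₃ : ∀ {x₀ x₁ x₂ x₃} → Path (x₀ ∷ x₁ ∷ x₂ ∷ x₃ ∷ []) → ¬ Sq (full G) x₀ x₃
    ¬Sq-ends-of-path₃ (distinct , path) (_ , inj₁ x₀~x₃) =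
      short-cycle-free _ (s<s z<s) distinct path (Adj-sym G x₀~x₃)
    ¬Sq-ends-of-path₃ {x₀} {x₁} {x₂} {x₃}
      ( (x₀≢x₁ ∷ x₀≢x₂ ∷ x₀≢x₃ ∷ []) ∷ (x₁≢x₂ ∷ x₁≢x₃ ∷ []) ∷ (x₂≢x₃ ∷ []) ∷ [] ∷ []
      , x₀~x₁ ∷ x₁~x₂ ∷ x₂~x₃ ∷ [-])
      (_ , inj₂ (m , x₀~m , m~x₃)) with m ≟ x₁ | m ≟ x₂
    ... | yes refl | _ = triangle-free x₁~x₂ x₂~x₃ (Adj-sym G m~x₃)
    ... | _ | yes refl = triangle-free x₀~x₁ x₁~x₂ (Adj-sym G x₀~m)
    ... | no m≢x₁ | no m≢x₂ = short-cycle-free (x₀ ∷ x₁ ∷ x₂ ∷ x₃ ∷ m ∷ []) (s<s (s<s z<s))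
      ( (x₀≢x₁ ∷ x₀≢x₂ ∷ x₀≢x₃ ∷ Adj⇒≢ G x₀~m ∷ [])
      ∷ (x₁≢x₂ ∷ x₁≢x₃ ∷ ≢-sym m≢x₁ ∷ [])
      ∷ (x₂≢x₃ ∷ ≢-sym m≢x₂ ∷ [])
      ∷ (≢-sym (Adj⇒≢ G m~x₃) ∷ []) ∷ [] ∷ [])
      (x₀~x₁ ∷ x₁~x₂ ∷ x₂~x₃ ∷ Adj-sym G m~x₃ ∷ [-]) (Adj-sym G x₀~m)

    ¬Sq-ends-of-path₄ : ∀ {x₀ x₁ x₂ x₃ x₄} → Path (x₀ ∷ x₁ ∷ x₂ ∷ x₃ ∷ x₄ ∷ []) → ¬ Sq (full G) x₀ x₄
    ¬Sq-ends-of-path₄ (distinct , path) (_ , inj₁ x₀~x₄) =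
      short-cycle-free _ (s<s (s<s z<s)) distinct path (Adj-sym G x₀~x₄)
    ¬Sq-ends-of-path₄ {x₀} {x₁} {x₂} {x₃} {x₄}
      ( (x₀≢x₁ ∷ x₀≢x₂ ∷ x₀≢x₃ ∷ x₀≢x₄ ∷ []) ∷ (x₁≢x₂ ∷ x₁≢x₃ ∷ x₁≢x₄ ∷ [])
        ∷ (x₂≢x₃ ∷ x₂≢x₄ ∷ []) ∷ (x₃≢x₄ ∷ []) ∷ [] ∷ []
      , x₀~x₁ ∷ x₁~x₂ ∷ x₂~x₃ ∷ x₃~x₄ ∷ [-])
      (_ , inj₂ (m , x₀~m , m~x₄)) with m ≟ x₁ | m ≟ x₂ | m ≟ x₃
    ... | yes refl | _ | _ = short-cycle-free (x₁ ∷ x₂ ∷ x₃ ∷ x₄ ∷ []) (s<s z<s)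
      ((x₁≢x₂ ∷ x₁≢x₃ ∷ x₁≢x₄ ∷ []) ∷ (x₂≢x₃ ∷ x₂≢x₄ ∷ []) ∷ (x₃≢x₄ ∷ []) ∷ [] ∷ [])
      (x₁~x₂ ∷ x₂~x₃ ∷ x₃~x₄ ∷ [-]) (Adj-sym G m~x₄)
    ... | _ | yes refl | _ = triangle-free x₀~x₁ x₁~x₂ (Adj-sym G x₀~m)
    ... | _ | _ | yes refl = short-cycle-free (x₀ ∷ x₁ ∷ x₂ ∷ x₃ ∷ []) (s<s z<s)
      ((x₀≢x₁ ∷ x₀≢x₂ ∷ x₀≢x₃ ∷ []) ∷ (x₁≢x₂ ∷ x₁≢x₃ ∷ []) ∷ (x₂≢x₃ ∷ []) ∷ [] ∷ [])
      (x₀~x₁ ∷ x₁~x₂ ∷ x₂~x₃ ∷ [-]) (Adj-sym G x₀~m)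
    ... | no m≢x₁ | no m≢x₂ | no m≢x₃ = short-cycle-free (x₀ ∷ x₁ ∷ x₂ ∷ x₃ ∷ x₄ ∷ m ∷ []) (s<s (s<s (s<s z<s)))
      ( (x₀≢x₁ ∷ x₀≢x₂ ∷ x₀≢x₃ ∷ x₀≢x₄ ∷ Adj⇒≢ G x₀~m ∷ [])
      ∷ (x₁≢x₂ ∷ x₁≢x₃ ∷ x₁≢x₄ ∷ ≢-sym m≢x₁ ∷ [])
      ∷ (x₂≢x₃ ∷ x₂≢x₄ ∷ ≢-sym m≢x₂ ∷ [])
      ∷ (x₃≢x₄ ∷ ≢-sym m≢x₃ ∷ [])
      ∷ (≢-sym (Adj⇒≢ G m~x₄) ∷ []) ∷ [] ∷ [])
      (x₀~x₁ ∷ x₁~x₂ ∷ x₂~x₃ ∷ x₃~x₄ ∷ Adj-sym G m~x₄ ∷ [-]) (Adj-sym G x₀~m)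

module Reduction {n} (G : Graph n) {Core : Set} (vertex : Core → Fin n)
  (locate : ∀ u → Dec (∃ λ i → vertex i ≡ u))
  (nbrsIn : Core → List Core) (nbrsOut : Core → List (Fin n))
  (nbhd : ∀ i → Nbrs⊆ G (vertex i) (map vertex (nbrsIn i) ++ nbrsOut i))
  (nbrsOut-≤1 : ∀ i → length (nbrsOut i) ≤ 1) where

  Outside : Fin n → Set
  Outside u = ∀ i → vertex i ≢ u

  keep : Fin n → Bool
  keep u = not (does (locate u))

  keep-outside : ∀ {u} → Outside u → keep u ≡ true
  keep-outside {u} out with locate u
  ... | yes (i , vi≡u) = contradiction vi≡u (out i)
  ... | no _ = refl

  keep-vertex : ∀ i → keep (vertex i) ≡ false
  keep-vertex i with locate (vertex i)
  ... | yes _ = refl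
  ... | no ¬∃ = contradiction (i , refl) ¬∃

  G∖core : Subgraph G
  G∖core = record
    { vs = keep
    ; ad = λ u x → (keep u ∧ keep x) ∧ adj G u x
    ; ad-sym = λ u x → cong₂ _∧_ (∧-comm (keep u) (keep x)) (Graph.sym G u x)
    ; ad⊆ = λ u x → ∧-conicalʳ _ _
    ; ad-vs = λ u x uxa → ∧-conicalˡ _ _ (∧-conicalˡ _ _ uxa) }

  G∖core-proper : Core → Proper G∖core
  G∖core-proper i = inj₁ (vertex i , keep-vertex i)

  outside-∈ : ∀ is {u ys} → Outside u → u ∈ map vertex is ++ ys → u ∈ ys
  outside-∈ [] out u∈ = u∈
  outside-∈ (i ∷ is) out (here refl) = contradiction refl (out i)
  outside-∈ (i ∷ is) out (there u∈) = outside-∈ is out u∈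

  outside-nbr : ∀ {i u} → Outside u → Adj G (vertex i) u → u ∈ nbrsOut i
  outside-nbr {i} out i~u = outside-∈ (nbrsIn i) out (nbhd i i~u)

  G∖core-adj : ∀ {u x} → Outside u → Outside x → Adj G u x → ad G∖core u x ≡ true
  G∖core-adj out-u out-x u~x rewrite keep-outside out-u | keep-outside out-x = u~x

  Sq-outside : ∀ {u x} → Outside u → Outside x → Sq (full G) u x → Sq G∖core u x
  Sq-outside out-u out-x (u≢x , inj₁ u~x) = u≢x , inj₁ (G∖core-adj out-u out-x u~x)
  Sq-outside out-u out-x (u≢x , inj₂ (m , u~m , m~x)) with locate m
  ... | yes (i , refl) = contradiction
        (∈-≤1⇒≡ (nbrsOut-≤1 i) (outside-nbr out-u (Adj-sym G u~m)) (outside-nbr out-x m~x)) u≢x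
  ... | no ¬∃ = u≢x , inj₂ (m , G∖core-adj out-u (curry ¬∃) u~m , G∖core-adj (curry ¬∃) out-x m~x)

  forbidden : Core → List (Fin n)
  forbidden i =
    nbrsOut i ++ concatMap nbrsOut (nbrsIn i) ++ concatMap (λ m → nbrsExcept G m (vertex i)) (nbrsOut i)

  forbidden-complete : ∀ i {u} → Outside u → Sq (full G) (vertex i) u → u ∈ forbidden i
  forbidden-complete i out (_ , inj₁ i~u) = ∈-++⁺ˡ (outside-nbr out i~u)
  forbidden-complete i out (_ , inj₂ (m , i~m , m~u)) with ∈-++⁻ (map vertex (nbrsIn i)) (nbhd i i~m)
  ... | inj₁ m∈ with j , j∈ , refl ← ∈-map⁻ vertex m∈ =
    ∈-++⁺ʳ (nbrsOut i) (∈-++⁺ˡ (∈-concatMap⁺ nbrsOut (lose j∈ (outside-nbr out m~u))))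
  ... | inj₂ m∈ =
    ∈-++⁺ʳ (nbrsOut i) (∈-++⁺ʳ (concatMap nbrsOut (nbrsIn i))
      (∈-concatMap⁺ (λ m → nbrsExcept G m (vertex i)) (lose m∈ (∈-nbrsExcept G m~u (≢-sym (out i))))))

  CoreChoosable : (Core → ℕ) → Set
  CoreChoosable size =
    (A : Core → List ℕ) → (∀ i → Unique (A i) × length (A i) ≡ size i) →
    Σ[ col ∈ (Core → ℕ) ] (∀ i → col i ∈ A i) ×
      (∀ i j → Sq (full G) (vertex i) (vertex j) → col i ≢ col j)

  extend : ∀ {k} (size : Core → ℕ) → (∀ i → length (forbidden i) + size i ≤ k) →
    CoreChoosable size → SqChoosable G∖core k → SqChoosable (full G) k
  extend size fits core-choosable choosable L L-ok
    with c , c∈ , c-proper ← choosable L (λ u _ → L-ok u refl)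
    = colour , (λ u _ → colour∈ u) , λ u x _ _ → colour-proper u x
    where
    available : ∀ i → Σ[ zs ∈ List ℕ ]
      Unique zs × length zs ≡ size i × zs ⊆ L (vertex i) × Disjoint zs (map c (forbidden i))
    available i =
      ∃-sublist-avoiding ℕ._≟_ (proj₁ (L-ok (vertex i) refl)) (map c (forbidden i)) (size i)
        (subst₂ _≤_ (cong (_+ size i) (sym (length-map c (forbidden i))))
          (sym (proj₂ (L-ok (vertex i) refl))) (fits i))

    A : Core → List ℕ
    A i = proj₁ (available i)

    core : Σ[ col ∈ (Core → ℕ) ] (∀ i → col i ∈ A i) ×
      (∀ i j → Sq (full G) (vertex i) (vertex j) → col i ≢ col j)
    core = core-choosable A (λ i → let _ , uniq , len , _ = available i in uniq , len)

    col : Core → ℕ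
    col = proj₁ core

    col∈L : ∀ i → col i ∈ L (vertex i)
    col∈L i = let _ , _ , _ , A⊆L , _ = available i in A⊆L (proj₁ (proj₂ core) i)

    col≢outside : ∀ i {x} → Outside x → Sq (full G) (vertex i) x → col i ≢ c x
    col≢outside i out sq col≡c =
      let _ , _ , _ , _ , A∩forbidden = available i in
      A∩forbidden (proj₁ (proj₂ core) i ,
        subst (_∈ map c (forbidden i)) (sym col≡c) (∈-map⁺ c (forbidden-complete i out sq)))

    colour : Fin n → ℕ
    colour u with locate u
    ... | yes (i , _) = col i
    ... | no _ = c u

    colour∈ : ∀ u → colour u ∈ L u
    colour∈ u with locate u
    ... | yes (i , refl) = col∈L i
    ... | no ¬∃ = c∈ u (keep-outside (curry ¬∃))

    colour-proper : ∀ u x → Sq (full G) u x → colour u ≢ colour x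
    colour-proper u x sq with locate u | locate x
    ... | yes (i , refl) | yes (j , refl) = proj₂ (proj₂ core) i j sq
    ... | yes (i , refl) | no ¬∃x = col≢outside i (curry ¬∃x) sq
    ... | no ¬∃u | yes (j , refl) = ≢-sym (col≢outside j (curry ¬∃u) (Sq-sym G sq))
    ... | no ¬∃u | no ¬∃x = c-proper u x (keep-outside (curry ¬∃u)) (keep-outside (curry ¬∃x))
      (Sq-outside (curry ¬∃u) (curry ¬∃x) sq)

data Core : Set where
  V A B W A₁ A₂ B₁ : Core

data CoreEdge : Core → Core → Set where
  A~V : CoreEdge A V
  A~B : CoreEdge A B
  A~W : CoreEdge A W
  A~A₁ : CoreEdge A A₁
  A~A₂ : CoreEdge A A₂
  V~B : CoreEdge V B
  V~W : CoreEdge V W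
  V~B₁ : CoreEdge V B₁
  V~A₁ : CoreEdge V A₁
  V~A₂ : CoreEdge V A₂
  B~B₁ : CoreEdge B B₁
  B~W : CoreEdge B W
  A₁~A₂ : CoreEdge A₁ A₂

coreSize : Core → ℕ
coreSize V = 4
coreSize A = 4
coreSize B = 2
coreSize B₁ = 2
coreSize W = 3
coreSize A₁ = 3
coreSize A₂ = 3

module CoreColouring {C : Set} (_≟_ : DecidableEquality C) (L : Core → List C)
  (L-unique : ∀ i → Unique (L i)) (L-size : ∀ i → length (L i) ≡ coreSize i) where

  ListColouring : Set
  ListColouring = Σ[ col ∈ (Core → C) ] (∀ i → col i ∈ L i) × (∀ {i j} → CoreEdge i j → col i ≢ col j)

  pick : ∀ i zs → length zs < coreSize i → ∃ λ c → c ∈ L i × c ∉ zs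
  pick i zs short = longer⇒∃∉ _≟_ zs (L-unique i) (subst (length zs <_) (sym (L-size i)) short)

  open DecMembership _≟_ using (_∈?_)

  |LA₁|<4 : length (L A₁) < 4
  |LA₁|<4 = subst (_< 4) (sym (L-size A₁)) ≤-refl

  |x∷LB|<4 : ∀ x → length (x ∷ L B) < 4
  |x∷LB|<4 _ = subst (λ k → suc k < 4) (sym (L-size B)) ≤-refl

  |LB|<3 : length (L B) < 3
  |LB|<3 = subst (_< 3) (sym (L-size B)) ≤-refl

  record OuterColouring : Set where
    field
      a v b b₁ w : C
      a∈ : a ∈ L A
      v∈ : v ∈ L V
      b∈ : b ∈ L B
      b₁∈ : b₁ ∈ L B₁
      w∈ : w ∈ L W
      a≢v : a ≢ v
      a≢b : a ≢ b
      a≢w : a ≢ w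
      v≢b : v ≢ b
      v≢w : v ≢ w
      v≢b₁ : v ≢ b₁
      b≢b₁ : b ≢ b₁
      b≢w : b ≢ w

  module _ (c : OuterColouring) where
    open OuterColouring c

    complete : ∀ {a₁ a₂} → a₁ ∈ L A₁ → a₂ ∈ L A₂ →
      a₁ ≢ a → a₁ ≢ v → a₂ ≢ a → a₂ ≢ v → a₁ ≢ a₂ → ListColouring
    complete {a₁} {a₂} a₁∈ a₂∈ a₁≢a a₁≢v a₂≢a a₂≢v a₁≢a₂ = col , col∈ , proper
      where
      col : Core → C
      col V = v
      col A = a
      col B = b
      col B₁ = b₁
      col W = w
      col A₁ = a₁
      col A₂ = a₂
      col∈ : ∀ i → col i ∈ L i
      col∈ V = v∈
      col∈ A = a∈
      col∈ B = b∈
      col∈ B₁ = b₁∈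
      col∈ W = w∈
      col∈ A₁ = a₁∈
      col∈ A₂ = a₂∈
      proper : ∀ {i j} → CoreEdge i j → col i ≢ col j
      proper A~V = a≢v
      proper A~B = a≢b
      proper A~W = a≢w
      proper A~A₁ = ≢-sym a₁≢a
      proper A~A₂ = ≢-sym a₂≢a
      proper V~B = v≢b
      proper V~W = v≢w
      proper V~B₁ = v≢b₁
      proper V~A₁ = ≢-sym a₁≢v
      proper V~A₂ = ≢-sym a₂≢v
      proper B~B₁ = b≢b₁
      proper B~W = b≢w
      proper A₁~A₂ = a₁≢a₂

    -- a₂ avoids the colours of a and v; a₁ can afford to avoid a₂ as well, since one of a, v has a
    -- colour outside L A₁.
    extend-A₁A₂ : a ∉ L A₁ ⊎ v ∉ L A₁ → ListColouring
    extend-A₁A₂ a∉⊎v∉ with a₂ , a₂∈ , a₂∉ ← pick A₂ (a ∷ v ∷ []) ≤-refl | a∉⊎v∉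
    ... | inj₁ a∉ with a₁ , a₁∈ , a₁∉ ← pick A₁ (v ∷ a₂ ∷ []) ≤-refl =
      complete a₁∈ a₂∈ (∈∧∉⇒≢ a₁∈ a∉) (∉-head a₁∉) (∉-head a₂∉) (∉-head (∉-tail a₂∉)) (∉-head (∉-tail a₁∉))
    ... | inj₂ v∉ with a₁ , a₁∈ , a₁∉ ← pick A₁ (a ∷ a₂ ∷ []) ≤-refl =
      complete a₁∈ a₂∈ (∉-head a₁∉) (∈∧∉⇒≢ a₁∈ v∉) (∉-head a₂∉) (∉-head (∉-tail a₂∉)) (∉-head (∉-tail a₁∉))

  colour-with-V : ∀ {p β y} → p ∈ L V → p ∉ L A₁ → β ∈ L B → y ∈ L B₁ →
    β ≢ p → y ≢ p → y ≢ β → ListColouring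
  colour-with-V {p} {β} {y} p∈ p∉ β∈ y∈ β≢p y≢p y≢β
    with ω , ω∈ , ω∉ ← pick W (p ∷ β ∷ []) ≤-refl
    with α , α∈ , α∉ ← pick A (β ∷ p ∷ ω ∷ []) ≤-refl
    = extend-A₁A₂ record
        { a = α ; v = p ; b = β ; b₁ = y ; w = ω
        ; a∈ = α∈ ; v∈ = p∈ ; b∈ = β∈ ; b₁∈ = y∈ ; w∈ = ω∈
        ; a≢v = ∉-head (∉-tail α∉) ; a≢b = ∉-head α∉ ; a≢w = ∉-head (∉-tail (∉-tail α∉))
        ; v≢b = ≢-sym β≢p ; v≢w = ≢-sym (∉-head ω∉) ; v≢b₁ = ≢-sym y≢p
        ; b≢b₁ = ≢-sym y≢β ; b≢w = ≢-sym (∉-head (∉-tail ω∉)) }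
        (inj₂ p∉)

  colour-unmatched-B₁ : ∀ {y} → y ∈ L B₁ → y ∉ L B → ListColouring
  colour-unmatched-B₁ {y} y∈ y∉ with p , p∈ , p∉ ← pick V (L A₁) |LA₁|<4 | y ≟ p
  ... | no y≢p with β , β∈ , β∉ ← pick B (p ∷ []) ≤-refl =
    colour-with-V p∈ p∉ β∈ y∈ (∉-head β∉) y≢p (≢-sym (∈∧∉⇒≢ β∈ y∉))
  ... | yes refl
    with y′ , y′∈ , y′∉ ← pick B₁ (y ∷ []) ≤-refl
    with β , β∈ , β∉ ← pick B (y′ ∷ []) ≤-refl =
    colour-with-V p∈ p∉ β∈ y′∈ (∈∧∉⇒≢ β∈ y∉) (∉-head y′∉) (≢-sym (∉-head β∉))

  colour-B₁⊆B : L B₁ ⊆ L B → ListColouring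
  colour-B₁⊆B B₁⊆B with α , α∈ , α∉ ← pick A (L A₁) |LA₁|<4 | α ∈? L B
  ... | yes α∈B
    with β , β∈ , β∉ ← pick B (α ∷ []) ≤-refl
    with ω , ω∈ , ω∉ ← pick W (L B) |LB|<3
    with ν , ν∈ , ν∉ ← pick V (ω ∷ L B) (|x∷LB|<4 ω)
    with y , y∈ , y∉ ← pick B₁ (β ∷ []) ≤-refl
    = extend-A₁A₂ record
        { a = α ; v = ν ; b = β ; b₁ = y ; w = ω
        ; a∈ = α∈ ; v∈ = ν∈ ; b∈ = β∈ ; b₁∈ = y∈ ; w∈ = ω∈
        ; a≢v = ∈∧∉⇒≢ α∈B (∉-tail ν∉) ; a≢b = ≢-sym (∉-head β∉) ; a≢w = ∈∧∉⇒≢ α∈B ω∉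
        ; v≢b = ≢-sym (∈∧∉⇒≢ β∈ (∉-tail ν∉)) ; v≢w = ∉-head ν∉
        ; v≢b₁ = ≢-sym (∈∧∉⇒≢ (B₁⊆B y∈) (∉-tail ν∉))
        ; b≢b₁ = ≢-sym (∉-head y∉) ; b≢w = ∈∧∉⇒≢ β∈ ω∉ }
        (inj₁ α∉)
  ... | no α∉B
    with ν , ν∈ , ν∉ ← pick V (α ∷ L B) (|x∷LB|<4 α)
    with ω , ω∈ , ω∉ ← pick W (α ∷ ν ∷ []) ≤-refl
    with β , β∈ , β∉ ← pick B (ω ∷ []) ≤-refl
    with y , y∈ , y∉ ← pick B₁ (β ∷ []) ≤-refl
    = extend-A₁A₂ record
        { a = α ; v = ν ; b = β ; b₁ = y ; w = ω
        ; a∈ = α∈ ; v∈ = ν∈ ; b∈ = β∈ ; b₁∈ = y∈ ; w∈ = ω∈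
        ; a≢v = ≢-sym (∉-head ν∉) ; a≢b = ≢-sym (∈∧∉⇒≢ β∈ α∉B) ; a≢w = ≢-sym (∉-head ω∉)
        ; v≢b = ≢-sym (∈∧∉⇒≢ β∈ (∉-tail ν∉)) ; v≢w = ≢-sym (∉-head (∉-tail ω∉))
        ; v≢b₁ = ≢-sym (∈∧∉⇒≢ (B₁⊆B y∈) (∉-tail ν∉))
        ; b≢b₁ = ≢-sym (∉-head y∉) ; b≢w = ∉-head β∉ }
        (inj₁ α∉)

  -- Either some colour of L B₁ is missing from L B, and then b, b₁ fit around a colour of v
  -- outside L A₁; or L B₁ ⊆ L B, and then a takes a colour outside L A₁ while v avoids L B.
  core-colouring : ListColouring
  core-colouring with any? (λ y → ¬? (y ∈? L B)) (L B₁)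
  ... | yes unmatched with y , y∈ , y∉ ← find unmatched = colour-unmatched-B₁ y∈ y∉
  ... | no none = colour-B₁⊆B (λ {y} y∈ → decidable-stable (y ∈? L B) (λ y∉ → none (lose y∈ y∉)))

record YConfiguration {n} (G : Graph n) : Set where
  field
    v a b w a₁ a₂ b₁ b₂ w′ a₁′ a₂′ b₁′ : Fin n
    deg-v : deg G v ≡ 3
    deg-a : deg G a ≡ 3
    deg-b : deg G b ≡ 3
    deg-w : deg G w ≡ 2
    deg-a₁ : deg G a₁ ≡ 2
    deg-a₂ : deg G a₂ ≡ 2
    deg-b₁ : deg G b₁ ≡ 2
    v~a : Adj G v a
    v~b : Adj G v b
    v~w : Adj G v w
    a~a₁ : Adj G a a₁
    a~a₂ : Adj G a a₂
    b~b₁ : Adj G b b₁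
    b~b₂ : Adj G b b₂
    w~w′ : Adj G w w′
    a₁~a₁′ : Adj G a₁ a₁′
    a₂~a₂′ : Adj G a₂ a₂′
    b₁~b₁′ : Adj G b₁ b₁′
    a≢b : a ≢ b
    N[v] : Nbrs⊆ G v (a ∷ b ∷ w ∷ [])
    N[a] : Nbrs⊆ G a (v ∷ a₁ ∷ a₂ ∷ [])
    N[b] : Nbrs⊆ G b (v ∷ b₁ ∷ b₂ ∷ [])
    N[w] : Nbrs⊆ G w (v ∷ w′ ∷ [])
    N[a₁] : Nbrs⊆ G a₁ (a ∷ a₁′ ∷ [])
    N[a₂] : Nbrs⊆ G a₂ (a ∷ a₂′ ∷ [])
    N[b₁] : Nbrs⊆ G b₁ (b ∷ b₁′ ∷ [])

yConfiguration : ∀ {n} {G : Graph n} {v} → YConf G v → YConfiguration G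
yConfiguration {G = G} {v} ((deg-v , class-v) , (a , v~a , deg-a , class-a) , (b , v~b , deg-b , class-b) , _)
  with w , v~w , deg-w , _ ← ∃-deg₂-neighbour-∉ G [] (subst (0 <_) (sym class-v) z<s)
  with a₁ , a~a₁ , deg-a₁ , _ ← ∃-deg₂-neighbour-∉ G [] (subst (0 <_) (sym class-a) z<s)
  with a₂ , a~a₂ , deg-a₂ , a₂∉ ← ∃-deg₂-neighbour-∉ G (a₁ ∷ []) (subst (1 <_) (sym class-a) ≤-refl)
  with b₁ , b~b₁ , deg-b₁ , _ ← ∃-deg₂-neighbour-∉ G [] (subst (0 <_) (sym class-b) z<s)
  with b₂ , b~b₂ , b₂∉ ← ∃-neighbour-∉ G (v ∷ b₁ ∷ []) (subst (2 <_) (sym deg-b) ≤-refl)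
  with w′ , w~w′ , N[w] ← second-neighbour G deg-w (Adj-sym G v~w)
  with a₁′ , a₁~a₁′ , N[a₁] ← second-neighbour G deg-a₁ (Adj-sym G a~a₁)
  with a₂′ , a₂~a₂′ , N[a₂] ← second-neighbour G deg-a₂ (Adj-sym G a~a₂)
  with b₁′ , b₁~b₁′ , N[b₁] ← second-neighbour G deg-b₁ (Adj-sym G b~b₁)
  = record
      { v = v ; a = a ; b = b ; w = w ; a₁ = a₁ ; a₂ = a₂ ; b₁ = b₁ ; b₂ = b₂
      ; w′ = w′ ; a₁′ = a₁′ ; a₂′ = a₂′ ; b₁′ = b₁′
      ; deg-v = deg-v ; deg-a = deg-a ; deg-b = deg-b ; deg-w = deg-w
      ; deg-a₁ = deg-a₁ ; deg-a₂ = deg-a₂ ; deg-b₁ = deg-b₁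
      ; v~a = v~a ; v~b = v~b ; v~w = v~w ; a~a₁ = a~a₁ ; a~a₂ = a~a₂ ; b~b₁ = b~b₁ ; b~b₂ = b~b₂
      ; w~w′ = w~w′ ; a₁~a₁′ = a₁~a₁′ ; a₂~a₂′ = a₂~a₂′ ; b₁~b₁′ = b₁~b₁′
      ; a≢b = a≢b
      ; N[v] = neighbours-⊆ G (≤-reflexive deg-v)
          ((a≢b ∷ deg₃≢deg₂ G deg-a deg-w ∷ []) ∷ (deg₃≢deg₂ G deg-b deg-w ∷ []) ∷ [] ∷ [])
          (v~a ∷ v~b ∷ v~w ∷ [])
      ; N[a] = neighbours-⊆ G (≤-reflexive deg-a)
          ((deg₃≢deg₂ G deg-v deg-a₁ ∷ deg₃≢deg₂ G deg-v deg-a₂ ∷ []) ∷ (≢-sym (∉-head a₂∉) ∷ []) ∷ [] ∷ [])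
          (Adj-sym G v~a ∷ a~a₁ ∷ a~a₂ ∷ [])
      ; N[b] = neighbours-⊆ G (≤-reflexive deg-b)
          ((deg₃≢deg₂ G deg-v deg-b₁ ∷ ≢-sym (∉-head b₂∉) ∷ []) ∷ (≢-sym (∉-head (∉-tail b₂∉)) ∷ []) ∷ [] ∷ [])
          (Adj-sym G v~b ∷ b~b₁ ∷ b~b₂ ∷ [])
      ; N[w] = N[w] ; N[a₁] = N[a₁] ; N[a₂] = N[a₂] ; N[b₁] = N[b₁] }
  where
  a≢b : a ≢ b
  a≢b a≡b with () ← trans (sym class-a) (trans (cong (deg2nbrs G) a≡b) class-b)

module _ {n} {G : Graph n} (Y : YConfiguration G) where
  open YConfiguration Y

  vertex : Core → Fin n
  vertex V = v
  vertex A = a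
  vertex B = b
  vertex W = w
  vertex A₁ = a₁
  vertex A₂ = a₂
  vertex B₁ = b₁

  allCores : List Core
  allCores = V ∷ A ∷ B ∷ W ∷ A₁ ∷ A₂ ∷ B₁ ∷ []

  ∈-allCores : ∀ i → i ∈ allCores
  ∈-allCores V = here refl
  ∈-allCores A = there (here refl)
  ∈-allCores B = there (there (here refl))
  ∈-allCores W = there (there (there (here refl)))
  ∈-allCores A₁ = there (there (there (there (here refl))))
  ∈-allCores A₂ = there (there (there (there (there (here refl)))))
  ∈-allCores B₁ = there (there (there (there (there (there (here refl))))))

  locate : ∀ u → Dec (∃ λ i → vertex i ≡ u)
  locate u = map′ satisfied (λ (i , vi≡u) → lose (∈-allCores i) vi≡u) (any? (λ i → vertex i ≟ u) allCores)

  nbrsIn : Core → List Core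
  nbrsIn V = A ∷ B ∷ W ∷ []
  nbrsIn A = V ∷ A₁ ∷ A₂ ∷ []
  nbrsIn B = V ∷ B₁ ∷ []
  nbrsIn W = V ∷ []
  nbrsIn A₁ = A ∷ []
  nbrsIn A₂ = A ∷ []
  nbrsIn B₁ = B ∷ []

  nbrsOut : Core → List (Fin n)
  nbrsOut V = []
  nbrsOut A = []
  nbrsOut B = b₂ ∷ []
  nbrsOut W = w′ ∷ []
  nbrsOut A₁ = a₁′ ∷ []
  nbrsOut A₂ = a₂′ ∷ []
  nbrsOut B₁ = b₁′ ∷ []

  nbhd : ∀ i → Nbrs⊆ G (vertex i) (map vertex (nbrsIn i) ++ nbrsOut i)
  nbhd V = N[v]
  nbhd A = N[a]
  nbhd B = N[b]
  nbhd W = N[w]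
  nbhd A₁ = N[a₁]
  nbhd A₂ = N[a₂]
  nbhd B₁ = N[b₁]

  nbrsOut-≤1 : ∀ i → length (nbrsOut i) ≤ 1
  nbrsOut-≤1 V = z≤n
  nbrsOut-≤1 A = z≤n
  nbrsOut-≤1 B = s≤s z≤n
  nbrsOut-≤1 W = s≤s z≤n
  nbrsOut-≤1 A₁ = s≤s z≤n
  nbrsOut-≤1 A₂ = s≤s z≤n
  nbrsOut-≤1 B₁ = s≤s z≤n

  open Reduction G vertex locate nbrsIn nbrsOut nbhd nbrsOut-≤1

  module _ (girth : GirthGe G 7) where

    a≁b₁ : ¬ Sq (full G) a b₁
    a≁b₁ = ¬Sq-ends-of-path₃ G girth
      ( (≢-sym (Adj⇒≢ G v~a) ∷ a≢b ∷ deg₃≢deg₂ G deg-a deg-b₁ ∷ [])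
        ∷ (Adj⇒≢ G v~b ∷ deg₃≢deg₂ G deg-v deg-b₁ ∷ []) ∷ (Adj⇒≢ G b~b₁ ∷ []) ∷ [] ∷ []
      , Adj-sym G v~a ∷ v~b ∷ b~b₁ ∷ [-])

    b₁≁w : ¬ Sq (full G) b₁ w
    b₁≁w = ¬Sq-ends-of-path₃ G girth
      ( (≢-sym (Adj⇒≢ G b~b₁) ∷ ≢-sym (deg₃≢deg₂ G deg-v deg-b₁) ∷ b₁≢w ∷ [])
        ∷ (≢-sym (Adj⇒≢ G v~b) ∷ deg₃≢deg₂ G deg-b deg-w ∷ []) ∷ (Adj⇒≢ G v~w ∷ []) ∷ [] ∷ []
      , Adj-sym G b~b₁ ∷ Adj-sym G v~b ∷ v~w ∷ [-])
      where
      b₁≢w : b₁ ≢ w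
      b₁≢w b₁≡w = triangle-free G girth v~b (subst (Adj G b) b₁≡w b~b₁) (Adj-sym G v~w)

    module Deg₂NbrOfA {x} (a~x : Adj G a x) (deg-x : deg G x ≡ 2) where

      x≁b : ¬ Sq (full G) x b
      x≁b = ¬Sq-ends-of-path₃ G girth
        ( (≢-sym (Adj⇒≢ G a~x) ∷ ≢-sym (deg₃≢deg₂ G deg-v deg-x) ∷ ≢-sym (deg₃≢deg₂ G deg-b deg-x) ∷ [])
          ∷ (≢-sym (Adj⇒≢ G v~a) ∷ a≢b ∷ []) ∷ (Adj⇒≢ G v~b ∷ []) ∷ [] ∷ []
        , Adj-sym G a~x ∷ Adj-sym G v~a ∷ v~b ∷ [-])

      x≁w : ¬ Sq (full G) x w
      x≁w = ¬Sq-ends-of-path₃ G girth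
        ( (≢-sym (Adj⇒≢ G a~x) ∷ ≢-sym (deg₃≢deg₂ G deg-v deg-x) ∷ x≢w ∷ [])
          ∷ (≢-sym (Adj⇒≢ G v~a) ∷ deg₃≢deg₂ G deg-a deg-w ∷ []) ∷ (Adj⇒≢ G v~w ∷ []) ∷ [] ∷ []
        , Adj-sym G a~x ∷ Adj-sym G v~a ∷ v~w ∷ [-])
        where
        x≢w : x ≢ w
        x≢w x≡w = triangle-free G girth v~a a~x (subst (λ u → Adj G u v) (sym x≡w) (Adj-sym G v~w))

      x≁b₁ : ¬ Sq (full G) x b₁
      x≁b₁ = ¬Sq-ends-of-path₄ G girth
        ( (≢-sym (Adj⇒≢ G a~x) ∷ ≢-sym (deg₃≢deg₂ G deg-v deg-x) ∷ ≢-sym (deg₃≢deg₂ G deg-b deg-x) ∷ x≢b₁ ∷ [])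
          ∷ (≢-sym (Adj⇒≢ G v~a) ∷ a≢b ∷ deg₃≢deg₂ G deg-a deg-b₁ ∷ [])
          ∷ (Adj⇒≢ G v~b ∷ deg₃≢deg₂ G deg-v deg-b₁ ∷ []) ∷ (Adj⇒≢ G b~b₁ ∷ []) ∷ [] ∷ []
        , Adj-sym G a~x ∷ Adj-sym G v~a ∷ v~b ∷ b~b₁ ∷ [-])
        where
        x≢b₁ : x ≢ b₁
        x≢b₁ x≡b₁ = x≁b (≢-sym (deg₃≢deg₂ G deg-b deg-x) , inj₁ (Adj-sym G (subst (Adj G b) (sym x≡b₁) b~b₁)))

    open Deg₂NbrOfA a~a₁ deg-a₁ renaming (x≁b to a₁≁b; x≁w to a₁≁w; x≁b₁ to a₁≁b₁)
    open Deg₂NbrOfA a~a₂ deg-a₂ renaming (x≁b to a₂≁b; x≁w to a₂≁w; x≁b₁ to a₂≁b₁)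

    core-sq : ∀ i j → Sq (full G) (vertex i) (vertex j) → CoreEdge i j ⊎ CoreEdge j i
    core-sq V V (v≢v , _) = contradiction refl v≢v
    core-sq V A _ = inj₂ A~V
    core-sq V B _ = inj₁ V~B
    core-sq V W _ = inj₁ V~W
    core-sq V A₁ _ = inj₁ V~A₁
    core-sq V A₂ _ = inj₁ V~A₂
    core-sq V B₁ _ = inj₁ V~B₁
    core-sq A V _ = inj₁ A~V
    core-sq A A (a≢a , _) = contradiction refl a≢a
    core-sq A B _ = inj₁ A~B
    core-sq A W _ = inj₁ A~W
    core-sq A A₁ _ = inj₁ A~A₁
    core-sq A A₂ _ = inj₁ A~A₂
    core-sq A B₁ sq = contradiction sq a≁b₁
    core-sq B V _ = inj₂ V~B
    core-sq B A _ = inj₂ A~B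
    core-sq B B (b≢b , _) = contradiction refl b≢b
    core-sq B W _ = inj₁ B~W
    core-sq B A₁ sq = contradiction (Sq-sym G sq) a₁≁b
    core-sq B A₂ sq = contradiction (Sq-sym G sq) a₂≁b
    core-sq B B₁ _ = inj₁ B~B₁
    core-sq W V _ = inj₂ V~W
    core-sq W A _ = inj₂ A~W
    core-sq W B _ = inj₂ B~W
    core-sq W W (w≢w , _) = contradiction refl w≢w
    core-sq W A₁ sq = contradiction (Sq-sym G sq) a₁≁w
    core-sq W A₂ sq = contradiction (Sq-sym G sq) a₂≁w
    core-sq W B₁ sq = contradiction (Sq-sym G sq) b₁≁w
    core-sq A₁ V _ = inj₂ V~A₁
    core-sq A₁ A _ = inj₂ A~A₁
    core-sq A₁ B sq = contradiction sq a₁≁b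
    core-sq A₁ W sq = contradiction sq a₁≁w
    core-sq A₁ A₁ (a₁≢a₁ , _) = contradiction refl a₁≢a₁
    core-sq A₁ A₂ _ = inj₁ A₁~A₂
    core-sq A₁ B₁ sq = contradiction sq a₁≁b₁
    core-sq A₂ V _ = inj₂ V~A₂
    core-sq A₂ A _ = inj₂ A~A₂
    core-sq A₂ B sq = contradiction sq a₂≁b
    core-sq A₂ W sq = contradiction sq a₂≁w
    core-sq A₂ A₁ _ = inj₂ A₁~A₂
    core-sq A₂ A₂ (a₂≢a₂ , _) = contradiction refl a₂≢a₂
    core-sq A₂ B₁ sq = contradiction sq a₂≁b₁
    core-sq B₁ V _ = inj₂ V~B₁
    core-sq B₁ A sq = contradiction (Sq-sym G sq) a≁b₁
    core-sq B₁ B _ = inj₂ B~B₁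
    core-sq B₁ W sq = contradiction sq b₁≁w
    core-sq B₁ A₁ sq = contradiction (Sq-sym G sq) a₁≁b₁
    core-sq B₁ A₂ sq = contradiction (Sq-sym G sq) a₂≁b₁
    core-sq B₁ B₁ (b₁≢b₁ , _) = contradiction refl b₁≢b₁

    core-choosable : CoreChoosable coreSize
    core-choosable L L-ok
      with col , col∈ , proper ← CoreColouring.core-colouring ℕ._≟_ L (proj₁ ∘ L-ok) (proj₂ ∘ L-ok)
      = col , col∈ , λ i j sq → [ proper , ≢-sym ∘ proper ] (core-sq i j sq)

  module _ (max-deg : MaxDegLe G 3) where

    |concatMap-nbrsExcept|≤2 : ∀ {y x} → Adj G y x → length (concatMap (λ m → nbrsExcept G m x) (y ∷ [])) ≤ 2
    |concatMap-nbrsExcept|≤2 {y} {x} y~x = subst (_≤ 2) (sym (cong length (++-identityʳ (nbrsExcept G y x))))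
      (≤-pred (≤-trans (|nbrsExcept|<deg G y~x) (max-deg y)))

    forbidden-fits : ∀ i → length (forbidden i) + coreSize i ≤ 6
    forbidden-fits V = ≤-refl
    forbidden-fits A = ≤-refl
    forbidden-fits B = s≤s (s≤s (+-monoˡ-≤ 2 (|concatMap-nbrsExcept|≤2 (Adj-sym G b~b₂))))
    forbidden-fits W = s≤s (+-monoˡ-≤ 3 (|concatMap-nbrsExcept|≤2 (Adj-sym G w~w′)))
    forbidden-fits A₁ = s≤s (+-monoˡ-≤ 3 (|concatMap-nbrsExcept|≤2 (Adj-sym G a₁~a₁′)))
    forbidden-fits A₂ = s≤s (+-monoˡ-≤ 3 (|concatMap-nbrsExcept|≤2 (Adj-sym G a₂~a₂′)))
    forbidden-fits B₁ = s≤s (s≤s (+-monoˡ-≤ 2 (|concatMap-nbrsExcept|≤2 (Adj-sym G b₁~b₁′))))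

  reducible : ((H : Subgraph G) → Proper H → SqChoosable H 6) → MaxDegLe G 3 → GirthGe G 7 →
    SqChoosable (full G) 6
  reducible minimal max-deg girth =
    extend coreSize (forbidden-fits max-deg) (core-choosable girth) (minimal G∖core (G∖core-proper V))

lemma19 : ∀ {n : ℕ} (G : Graph n) →
    Minimal G 6 → MaxDegLe G 3 → GirthGe G 7 →
    ∀ (v : Fin n) → ¬ YConf G v
lemma19 G (not-choosable , minimal) max-deg girth v y-conf =
  not-choosable (reducible (yConfiguration y-conf) minimal max-deg girth)
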